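{- Let $S, S'$ be sets of formulas, let $M \subseteq \mathcal A$, and let $A$ be a set of literals with $M\cup A\subseteq\mathcal A$. If $S \cup M \equiv_{\mathcal T} S' \cup M$, then $\mathcal I_{M,A}(S) = \mathcal I_{M,A}(S')$.
   Context: $\mathcal{T}$ is a theory; formulas are ground and quantifier-free. $\models_{\mathcal T}$ denotes entailment in all models of $\mathcal T$. $X\equiv_{\mathcal T} Y$ means $X\models_{\mathcal T} Y$ and $Y\models_{\mathcal T} X$. Clauses are finite disjunctions of literals without repetition. For a literal $l$, $\overline{l}$ is its complement. For a set of literals $Q=\{l_1,\dots,l_n\}$, $\overline{Q}$ is the clause $\overline{l_1}\vee\dots\vee\overline{l_n}$. For a clause $C$, $\overline{C}$ is the set of complements of its literals. $\mathcal A$ is a fixed finite set of literals (abducible literals), each $\mathcal T$-satisfiable. A clause $C$ is a $(\mathcal T,\mathcal A)$-implicate of a set of formulas $S$ if $\overline{C}\subseteq\mathcal A$ and $S\models_{\mathcal T} C$; $\mathcal I(S)$ denotes the set of these implicates. For sets of literals $M,A$ with $M\cup A\subseteq\mathcal A$, define $\mathcal I_{M,A}(S)=\{C\in\mathcal I(S) \mid \exists Q\subseteq A,\ C=\overline{M}\vee\overline{Q}\}$. -}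

module Defs where

open import Data.Bool using (Bool; true; false; not; _∧_; _∨_)
open import Data.List using (List; []; _∷_)
open import Data.List.Membership.Propositional using (_∈_)
open import Data.List.Relation.Unary.All using (All)
open import Data.List.Relation.Unary.Unique.Propositional using (Unique)
open import Data.Product using (Σ; _×_; ∃)
open import Data.Sum using (_⊎_)
open import Relation.Binary.PropositionalEquality using (_≡_)
open import Function.Bundles using (_⇔_)

-- A ground QF formula's truth in a first-order structure depends only on the
-- truth values of its ground atoms, so a model is represented by its atom
-- valuation, and a theory T by the predicate "this valuation is realised by a
-- model of T".
module _ (Atom : Set) where

  data Formula : Set where
    atom : Atom → Formula
    ⊤f ⊥f : Formula
    ¬f   : Formula → Formula
    _∧f_ _∨f_ : Formula → Formula → Formula

  data Literal : Set where
    pos neg : Atom → Literal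

Valuation : Set → Set
Valuation Atom = Atom → Bool

module Logic {Atom : Set} where

  ⟦_⟧ : Formula Atom → Valuation Atom → Bool
  ⟦ atom a ⟧ v = v a
  ⟦ ⊤f ⟧ v = true
  ⟦ ⊥f ⟧ v = false
  ⟦ ¬f φ ⟧ v = not (⟦ φ ⟧ v)
  ⟦ φ ∧f ψ ⟧ v = ⟦ φ ⟧ v ∧ ⟦ ψ ⟧ v
  ⟦ φ ∨f ψ ⟧ v = ⟦ φ ⟧ v ∨ ⟦ ψ ⟧ v

  compl : Literal Atom → Literal Atom
  compl (pos a) = neg a
  compl (neg a) = pos a

  litF : Literal Atom → Formula Atom
  litF (pos a) = atom a
  litF (neg a) = ¬f (atom a)

  record Clause : Set where
    constructor clause
    field
      lits   : List (Literal Atom)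
      unique : Unique lits
  open Clause public

  clauseF : List (Literal Atom) → Formula Atom
  clauseF [] = ⊥f
  clauseF (l ∷ ls) = litF l ∨f clauseF ls

  FSet : Set₁
  FSet = Formula Atom → Set

  Theory : Set₁
  Theory = Valuation Atom → Set

  _sats_ : Valuation Atom → FSet → Set
  v sats S = ∀ φ → S φ → ⟦ φ ⟧ v ≡ true

  _⊨[_]_ : FSet → Theory → Formula Atom → Set
  S ⊨[ T ] φ = ∀ v → T v → v sats S → ⟦ φ ⟧ v ≡ true

  _⊨ˢ[_]_ : FSet → Theory → FSet → Set
  X ⊨ˢ[ T ] Y = ∀ φ → Y φ → X ⊨[ T ] φ

  _≡[_]_ : FSet → Theory → FSet → Set
  X ≡[ T ] Y = (X ⊨ˢ[ T ] Y) × (Y ⊨ˢ[ T ] X)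

  _∪L_ : FSet → List (Literal Atom) → FSet
  (S ∪L M) φ = S φ ⊎ ∃ λ l → l ∈ M × φ ≡ litF l

  TSat : Theory → Literal Atom → Set
  TSat T l = ∃ λ v → T v × ⟦ litF l ⟧ v ≡ true

  _⊆L_ : List (Literal Atom) → List (Literal Atom) → Set
  X ⊆L Y = ∀ {l} → l ∈ X → l ∈ Y

  IsImplicate : Theory → List (Literal Atom) → FSet → Clause → Set
  IsImplicate T 𝒜 S C =
    (∀ l → l ∈ lits C → compl l ∈ 𝒜) × (S ⊨[ T ] clauseF (lits C))

  -- C ∈ 𝓘_{M,A}(S): C is an implicate and C = M̄ ∨ Q̄ for some Q ⊆ A
  -- (clause equality = equality of the sets of literals)
  InIMA : Theory → List (Literal Atom) → List (Literal Atom) → List (Literal Atom)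
        → FSet → Clause → Set
  InIMA T 𝒜 M A S C =
    IsImplicate T 𝒜 S C ×
    (Σ (List (Literal Atom)) λ Q → Q ⊆L A ×
       (∀ l → (l ∈ lits C) ⇔ (compl l ∈ M ⊎ compl l ∈ Q)))

module Submission where

-- Every clause C ∈ 𝓘_{M,A}(S') has the shape M̄ ∨ Q̄, so it contains
-- the complement of every literal of M.  Such a clause is entailed by S as
-- soon as it is entailed by S ∪ M: in a model of S where some literal of M
-- is false, its complement (a literal of C) is true; in a model where all of
-- M is true, the model satisfies S ∪ M.  And S ∪ M entails C because it
-- entails S' ∪ M, which entails C by monotonicity.  The side conditions on
-- C (abducibility, the decomposition M̄ ∨ Q̄) do not mention S, so they are
-- carried over unchanged.

open import Defs
open Defs.Logic
open import Data.Bool using (true; false; not)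
open import Data.Bool.Properties using (not-involutive)
open import Data.List using (List; []; _∷_)
open import Data.List.Membership.Propositional using (_∈_)
open import Data.List.Relation.Unary.All using (All)
open import Data.List.Relation.Unary.Any using (here; there)
open import Data.Product using (∃; _×_; _,_)
open import Data.Sum using (_⊎_; inj₁; inj₂)
open import Function.Bundles using (_⇔_; mk⇔; Equivalence)
open import Relation.Binary.PropositionalEquality using (_≡_; refl; sym; subst)

module _ {Atom : Set} where

  compl-involutive : (l : Literal Atom) → compl (compl l) ≡ l
  compl-involutive (pos a) = refl
  compl-involutive (neg a) = refl

  ⟦compl⟧ : (l : Literal Atom) (v : Valuation Atom)
          → ⟦ litF (compl l) ⟧ v ≡ not (⟦ litF l ⟧ v)
  ⟦compl⟧ (pos a) v = refl
  ⟦compl⟧ (neg a) v = sym (not-involutive (v a))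

  compl-true : (l : Literal Atom) (v : Valuation Atom)
             → ⟦ litF l ⟧ v ≡ false → ⟦ litF (compl l) ⟧ v ≡ true
  compl-true l v l-false rewrite ⟦compl⟧ l v | l-false = refl

  clause-true : (ls : List (Literal Atom)) (v : Valuation Atom) {l : Literal Atom}
              → l ∈ ls → ⟦ litF l ⟧ v ≡ true → ⟦ clauseF ls ⟧ v ≡ true
  clause-true (x ∷ ls) v (here refl) l-true rewrite l-true = refl
  clause-true (x ∷ ls) v (there l∈ls) l-true with ⟦ litF x ⟧ v
  ... | true  = refl
  ... | false = clause-true ls v l∈ls l-true

  all-true-or-one-false : (M : List (Literal Atom)) (v : Valuation Atom)
    → (∀ {l} → l ∈ M → ⟦ litF l ⟧ v ≡ true)
      ⊎ (∃ λ l → l ∈ M × ⟦ litF l ⟧ v ≡ false)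
  all-true-or-one-false [] v = inj₁ (λ ())
  all-true-or-one-false (x ∷ M) v with ⟦ litF x ⟧ v in x-value
  ... | false = inj₂ (x , here refl , x-value)
  ... | true with all-true-or-one-false M v
  ...   | inj₁ rest-true = inj₁ λ { (here refl) → x-value ; (there l∈M) → rest-true l∈M }
  ...   | inj₂ (l , l∈M , l-false) = inj₂ (l , there l∈M , l-false)

  ⊨-∪L : (T : Theory {Atom}) (S : FSet {Atom}) (M : List (Literal Atom))
         (φ : Formula Atom) → S ⊨[ T ] φ → (S ∪L M) ⊨[ T ] φ
  ⊨-∪L T S M φ S⊨φ v Tv v⊨S∪M = S⊨φ v Tv (λ ψ Sψ → v⊨S∪M ψ (inj₁ Sψ))

  ⊨-cut : (T : Theory {Atom}) (X Y : FSet {Atom}) (φ : Formula Atom)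
          → X ⊨ˢ[ T ] Y → Y ⊨[ T ] φ → X ⊨[ T ] φ
  ⊨-cut T X Y φ X⊨Y Y⊨φ v Tv v⊨X = Y⊨φ v Tv (λ ψ Yψ → X⊨Y ψ Yψ v Tv v⊨X)

  -- The literals M may be dropped from the premises of a clause containing
  -- the complement of each of them: the clause is then implied by M̄.
  discharge : (T : Theory {Atom}) (S : FSet {Atom}) (M ls : List (Literal Atom))
    → (∀ {l} → l ∈ M → compl l ∈ ls)
    → (S ∪L M) ⊨[ T ] clauseF ls → S ⊨[ T ] clauseF ls
  discharge T S M ls M̄⊆ls S∪M⊨C v Tv v⊨S with all-true-or-one-false M v
  ... | inj₁ M-true = S∪M⊨C v Tv v⊨S∪M
    where
    v⊨S∪M : v sats (S ∪L M)
    v⊨S∪M φ (inj₁ Sφ)                = v⊨S φ Sφ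
    v⊨S∪M φ (inj₂ (l , l∈M , refl)) = M-true l∈M
  ... | inj₂ (l , l∈M , l-false) =
    clause-true ls v (M̄⊆ls l∈M) (compl-true l v l-false)

  M̄⊆IMA : (M Q : List (Literal Atom)) (C : Clause {Atom})
    → (∀ l → (l ∈ lits C) ⇔ (compl l ∈ M ⊎ compl l ∈ Q))
    → ∀ {l} → l ∈ M → compl l ∈ lits C
  M̄⊆IMA M Q C shape {l} l∈M =
    Equivalence.from (shape (compl l))
      (inj₁ (subst (_∈ M) (sym (compl-involutive l)) l∈M))

  IMA-transfer : (T : Theory {Atom}) (𝒜 : List (Literal Atom))
    (S S' : FSet {Atom}) (M A : List (Literal Atom))
    → (S ∪L M) ⊨ˢ[ T ] (S' ∪L M)
    → (C : Clause {Atom}) → InIMA T 𝒜 M A S' C → InIMA T 𝒜 M A S C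
  IMA-transfer T 𝒜 S S' M A S∪M⊨S'∪M C ((abducible , S'⊨C) , Q , Q⊆A , shape) =
    (abducible , S⊨C) , Q , Q⊆A , shape
    where
    φ : Formula Atom
    φ = clauseF (lits C)

    S⊨C : S ⊨[ T ] φ
    S⊨C = discharge T S M (lits C) (M̄⊆IMA M Q C shape)
            (⊨-cut T (S ∪L M) (S' ∪L M) φ S∪M⊨S'∪M (⊨-∪L T S' M φ S'⊨C))

proposition3 : {Atom : Set} (T : Theory {Atom}) (𝒜 : List (Literal Atom))
    → All (TSat T) 𝒜
    → (S S' : FSet {Atom}) (M A : List (Literal Atom))
    → M ⊆L 𝒜 → A ⊆L 𝒜
    → (S ∪L M) ≡[ T ] (S' ∪L M)
    → (C : Clause {Atom}) → InIMA T 𝒜 M A S C ⇔ InIMA T 𝒜 M A S' C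
proposition3 T 𝒜 _ S S' M A _ _ (S∪M⊨S'∪M , S'∪M⊨S∪M) C =
  mk⇔ (IMA-transfer T 𝒜 S' S M A S'∪M⊨S∪M C)
      (IMA-transfer T 𝒜 S S' M A S∪M⊨S'∪M C)
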